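{- Every quantifier-free formula in the first-order language of graphs has finite VC-dimension on the class $\mathcal{J}$ of all Johnson graphs.
   Context: The first-order language of graphs has atomic formulas $Exy$ (adjacency) and $x=y$; quantifier-free formulas are Boolean combinations of atomic formulas. For a formula $\phi(\bar x;\bar y)$ with its free variables partitioned into tuples $\bar x,\bar y$ and a graph $G$, the associated set system is $(V(G)^{|\bar x|},\{\{\bar a: G\models\phi(\bar a,\bar b)\}:\bar b\in V(G)^{|\bar y|}\})$; a set $A$ is shattered if its traces form its full power set, and the VC-dimension is the supremum of sizes of shattered sets. The formula has finite VC-dimension on a class of graphs if the supremum of these VC-dimensions over graphs in the class is finite. For $m\ge k$ and $|X|=m$, the Johnson graph $J(m,k)$ has vertex set $\binom{X}{k}$, two vertices adjacent iff their intersection has size $k-1$; $\mathcal{J}=\{J(m,k):k\le m\}$. -}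

module Defs where

open import Data.Nat using (ℕ; suc; _≤_)
open import Data.Fin using (Fin)
open import Data.Fin.Subset using (Subset; _∩_; ∣_∣; _∈_)
open import Data.Sum using (_⊎_; inj₁; inj₂)
open import Data.Product using (Σ; ∃; _×_; proj₁)
open import Data.Empty using (⊥)
open import Data.Unit using (⊤)
open import Relation.Nullary using (¬_)
open import Relation.Binary.PropositionalEquality using (_≡_)
open import Function.Definitions using (Injective)
open import Function.Bundles using (_⇔_)

record Graph : Set₁ where
  field
    V : Set
    E : V → V → Set
open Graph public

data QF (X : Set) : Set where
  tt ff   : QF X
  adj     : X → X → QF X
  eq      : X → X → QF X
  neg     : QF X → QF X
  conj    : QF X → QF X → QF X
  disj    : QF X → QF X → QF X

Sat : (G : Graph) {X : Set} → (X → V G) → QF X → Set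
Sat G ρ tt = ⊤
Sat G ρ ff = ⊥
Sat G ρ (adj x y) = E G (ρ x) (ρ y)
Sat G ρ (eq x y) = ρ x ≡ ρ y
Sat G ρ (neg φ) = ¬ Sat G ρ φ
Sat G ρ (conj φ ψ) = Sat G ρ φ × Sat G ρ ψ
Sat G ρ (disj φ ψ) = Sat G ρ φ ⊎ Sat G ρ ψ

-- Assignment for φ(x̄ ; ȳ): x̄ gets a : Fin p → V, ȳ gets b : Fin q → V.
[_,_] : {A : Set} {p q : ℕ} → (Fin p → A) → (Fin q → A) → (Fin p ⊎ Fin q → A)
[ a , b ] (inj₁ i) = a i
[ a , b ] (inj₂ j) = b j

-- A set A ⊆ V^p of size s, given as an injective enumeration a : Fin s → (Fin p → V),
-- is shattered by φ(x̄;ȳ) in G if every subset S of A is the trace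
-- {a_i : G ⊨ φ(a_i, b̄)} of some parameter tuple b̄ ∈ V^q.
Shattered : (G : Graph) {p q : ℕ} → QF (Fin p ⊎ Fin q) →
            {s : ℕ} → (Fin s → (Fin p → V G)) → Set
Shattered G {p} {q} φ {s} a =
  Injective _≡_ _≡_ a ×
  ((S : Subset s) → Σ (Fin q → V G) λ b →
     (i : Fin s) → Sat G [ a i , b ] φ ⇔ i ∈ S)

-- Johnson graph J(m,k): vertices are k-subsets of an m-set (Fin m),
-- adjacent iff their intersection has size k-1 (i.e. suc ∣ s ∩ t ∣ ≡ k).
Johnson : (m k : ℕ) → Graph
Johnson m k = record
  { V = Σ (Subset m) (λ s → ∣ s ∣ ≡ k)
  ; E = λ s t → suc ∣ proj₁ s ∩ proj₁ t ∣ ≡ k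
  }

FiniteVCdimOnJohnson : {p q : ℕ} → QF (Fin p ⊎ Fin q) → Set
FiniteVCdimOnJohnson {p} {q} φ =
  ∃ λ (d : ℕ) → (m k : ℕ) → k ≤ m → (s : ℕ) →
    (a : Fin s → (Fin p → V (Johnson m k))) →
    Shattered (Johnson m k) φ a → s ≤ d

-- A parameter tuple b̄ cuts out of A = {ā₁, …, āₛ} ⊆ V^p a trace that depends only on the
-- atomic type of each (āᵢ, b̄), and in J(m,k) the atomic type of a pair of k-sets x, y is
-- the "link" of |x ∩ y| (equal to k, equal to k - 1, or smaller).  Fix the n = s·p vertices
-- P_t occurring in A.  The links of a k-set y to all P_t are determined by a profile taking
-- only polynomially many values in n: either y = P_t for some t; or y is adjacent to some
-- x = P_t, i.e. y = x - e + f, and then |P_u ∩ y| = |P_u ∩ x| - [e ∈ P_u] + [f ∈ P_u] is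
-- at least k - 1 only if |x ∖ P_u| ≤ 2, so e and f matter only through their membership in
-- these small sets, which is fixed by naming one small set containing the element and its
-- position there; or y is linked to no P_t at all.  Hence the number of traces is polynomial
-- in s, and a shattered set of size s satisfies 2^s ≤ poly(s), which bounds s.

module Submission where

open import Defs
open import Data.Bool using (Bool; true; false; _∧_; not; if_then_else_)
open import Data.Bool.Properties using (∧-conicalˡ; ∧-conicalʳ; ∧-identityʳ; not-injective)
open import Data.Empty using (⊥-elim)
open import Data.Fin using (Fin; zero; suc; remQuot; combine; _↑ˡ_) renaming (_<_ to _<ᶠ_)
open import Data.Fin.Properties
  using (any?; <-cmp; +↔⊎; *↔×; 1↔⊤; 2↔Bool; remQuot-combine; injective⇒≤; ↑ˡ-injective)
  renaming (_<?_ to _<ᶠ?_; <-trans to <ᶠ-trans; <⇒≢ to <ᶠ⇒≢)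
open import Data.Fin.Subset using (Subset; _∩_; ∁; ∣_∣; _∈_; ⁅_⁆; ⊥; _-_)
open import Data.Fin.Subset.Properties
  using (∩-comm; ∩-idem; ∩-zeroʳ; ∣⊥∣≡0; ∣⁅x⁆∣≡1; ∣p∩q∣≤∣p∣; ∣p∩q∣≤∣q∣; x∈p⇒∣p-x∣<∣p∣;
         x∈p∧x≢y⇒x∈p-y; _∈?_; nonempty?; ⊆-antisym; x∈⁅x⁆; x∈⁅y⁆⇒x≡y)
open import Data.Maybe using (Maybe; just; nothing; maybe)
open import Data.Maybe.Properties using (just-injective)
open import Data.Nat using (ℕ; zero; suc; _+_; _*_; _^_; _≤_; _<_; z≤n; s≤s; z<s; _≟_; _≤?_)
open import Data.Nat.Properties
  using (+-suc; +-comm; +-identityʳ; *-assoc; suc-injective; +-cancelˡ-≡; +-cancelʳ-≡; 1+n≢n;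
         ≡-irrelevant; ≤-reflexive; ≤-trans; ≤-<-trans; <⇒≤; <⇒≢; <⇒≱; ≰⇒>; 1+n≰n; n≤1+n;
         m≤m+n; m<m+n; m≤m*n; m≤n⇒∃[o]m+o≡n; +-monoˡ-≤; +-monoʳ-≤; +-monoʳ-<; *-mono-≤;
         *-monoʳ-≤; *-mono-<; m^n>0; ^-monoˡ-≤; ^-monoʳ-<; ^-distribˡ-+-*; ^-*-assoc;
         module ≤-Reasoning)
open import Data.Nat.Tactic.RingSolver using (solve-∀)
open import Data.Product using (Σ; ∃; _×_; _,_; proj₁; proj₂; uncurry)
open import Data.Product.Properties using (,-injective)
open import Data.Product.Function.NonDependent.Propositional using (_×-⇔_; _×-↔_)
open import Data.Sum using (_⊎_; inj₁; inj₂)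
open import Data.Sum.Function.Propositional using (_⊎-⇔_; _⊎-↔_)
open import Data.Unit using (⊤)
open import Data.Vec using (Vec; []; _∷_; lookup; uncons; tabulate; _++_)
open import Data.Vec.Properties
  using ([]=⇒lookup; lookup⇒[]=; lookup-zipWith; lookup-map; lookup∘tabulate; lookup-++ˡ)
open import Function.Bundles
  using (_⇔_; mk⇔; Equivalence; _↔_; mk↔ₛ′; _↣_; mk↣; Injection)
open import Function.Construct.Composition using (_⇔-∘_; _↔-∘_; _↣-∘_)
open import Function.Construct.Identity using (⇔-id; ↔-id)
open import Function.Construct.Symmetry using (⇔-sym; ↔-sym)
open import Function.Properties.Inverse using (↔⇒↣)
open import Function.Related.TypeIsomorphisms using (→-cong-⇔)
open import Relation.Binary using (tri<; tri≈; tri>)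
open import Relation.Binary.PropositionalEquality
  using (_≡_; _≢_; refl; sym; trans; cong; subst; subst₂; ≢-sym; module ≡-Reasoning)
open import Relation.Nullary using (Dec; yes; no; does; _×-dec_)

∣p∩q∣≡∣q∩p∣ : ∀ {m} (p q : Subset m) → ∣ p ∩ q ∣ ≡ ∣ q ∩ p ∣
∣p∩q∣≡∣q∩p∣ p q = cong ∣_∣ (∩-comm p q)

∣p∩q∣+∣p∩∁q∣≡∣p∣ : ∀ {m} (p q : Subset m) → ∣ p ∩ q ∣ + ∣ p ∩ ∁ q ∣ ≡ ∣ p ∣
∣p∩q∣+∣p∩∁q∣≡∣p∣ []          []          = refl
∣p∩q∣+∣p∩∁q∣≡∣p∣ (true ∷ p)  (true ∷ q)  = cong suc (∣p∩q∣+∣p∩∁q∣≡∣p∣ p q)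
∣p∩q∣+∣p∩∁q∣≡∣p∣ (true ∷ p)  (false ∷ q) = trans (+-suc _ _) (cong suc (∣p∩q∣+∣p∩∁q∣≡∣p∣ p q))
∣p∩q∣+∣p∩∁q∣≡∣p∣ (false ∷ p) (_ ∷ q)     = ∣p∩q∣+∣p∩∁q∣≡∣p∣ p q

∣w∩y∣+∣w∩x∩∁y∣≡∣w∩x∣+∣w∩y∩∁x∣ : ∀ {m} (w x y : Subset m) →
  ∣ w ∩ y ∣ + ∣ w ∩ x ∩ ∁ y ∣ ≡ ∣ w ∩ x ∣ + ∣ w ∩ y ∩ ∁ x ∣
∣w∩y∣+∣w∩x∩∁y∣≡∣w∩x∣+∣w∩y∩∁x∣ []          []          []          = refl
∣w∩y∣+∣w∩x∩∁y∣≡∣w∩x∣+∣w∩y∩∁x∣ (false ∷ w) (_ ∷ x)     (_ ∷ y)     =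
  ∣w∩y∣+∣w∩x∩∁y∣≡∣w∩x∣+∣w∩y∩∁x∣ w x y
∣w∩y∣+∣w∩x∩∁y∣≡∣w∩x∣+∣w∩y∩∁x∣ (true ∷ w)  (true ∷ x)  (true ∷ y)  =
  cong suc (∣w∩y∣+∣w∩x∩∁y∣≡∣w∩x∣+∣w∩y∩∁x∣ w x y)
∣w∩y∣+∣w∩x∩∁y∣≡∣w∩x∣+∣w∩y∩∁x∣ (true ∷ w)  (true ∷ x)  (false ∷ y) =
  trans (+-suc _ _) (cong suc (∣w∩y∣+∣w∩x∩∁y∣≡∣w∩x∣+∣w∩y∩∁x∣ w x y))
∣w∩y∣+∣w∩x∩∁y∣≡∣w∩x∣+∣w∩y∩∁x∣ (true ∷ w)  (false ∷ x) (true ∷ y)  =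
  trans (cong suc (∣w∩y∣+∣w∩x∩∁y∣≡∣w∩x∣+∣w∩y∩∁x∣ w x y)) (sym (+-suc _ _))
∣w∩y∣+∣w∩x∩∁y∣≡∣w∩x∣+∣w∩y∩∁x∣ (true ∷ w)  (false ∷ x) (false ∷ y) =
  ∣w∩y∣+∣w∩x∩∁y∣≡∣w∩x∣+∣w∩y∩∁x∣ w x y

∣p∩q∣≡∣p∣≡∣q∣⇒p≡q : ∀ {m} (p q : Subset m) → ∣ p ∩ q ∣ ≡ ∣ p ∣ → ∣ p ∩ q ∣ ≡ ∣ q ∣ → p ≡ q
∣p∩q∣≡∣p∣≡∣q∣⇒p≡q []          []          _  _  = refl
∣p∩q∣≡∣p∣≡∣q∣⇒p≡q (true ∷ p)  (true ∷ q)  hp hq =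
  cong (true ∷_) (∣p∩q∣≡∣p∣≡∣q∣⇒p≡q p q (suc-injective hp) (suc-injective hq))
∣p∩q∣≡∣p∣≡∣q∣⇒p≡q (true ∷ p)  (false ∷ q) hp _  = ⊥-elim (1+n≰n (subst (_≤ ∣ p ∣) hp (∣p∩q∣≤∣p∣ p q)))
∣p∩q∣≡∣p∣≡∣q∣⇒p≡q (false ∷ p) (true ∷ q)  _  hq = ⊥-elim (1+n≰n (subst (_≤ ∣ q ∣) hq (∣p∩q∣≤∣q∣ p q)))
∣p∩q∣≡∣p∣≡∣q∣⇒p≡q (false ∷ p) (false ∷ q) hp hq = cong (false ∷_) (∣p∩q∣≡∣p∣≡∣q∣⇒p≡q p q hp hq)

∣p∩∁q∣≡∣q∩∁p∣ : ∀ {m} (p q : Subset m) → ∣ p ∣ ≡ ∣ q ∣ → ∣ p ∩ ∁ q ∣ ≡ ∣ q ∩ ∁ p ∣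
∣p∩∁q∣≡∣q∩∁p∣ p q ∣p∣≡∣q∣ = +-cancelˡ-≡ ∣ p ∩ q ∣ _ _ (begin
  ∣ p ∩ q ∣ + ∣ p ∩ ∁ q ∣ ≡⟨ ∣p∩q∣+∣p∩∁q∣≡∣p∣ p q ⟩
  ∣ p ∣                   ≡⟨ ∣p∣≡∣q∣ ⟩
  ∣ q ∣                   ≡⟨ ∣p∩q∣+∣p∩∁q∣≡∣p∣ q p ⟨
  ∣ q ∩ p ∣ + ∣ q ∩ ∁ p ∣ ≡⟨ cong (_+ ∣ q ∩ ∁ p ∣) (∣p∩q∣≡∣q∩p∣ q p) ⟩
  ∣ p ∩ q ∣ + ∣ q ∩ ∁ p ∣ ∎)
  where open ≡-Reasoning

∣p∣≡k⇒∣p∩∁q∣≡1 : ∀ {m k} (p q : Subset m) → ∣ p ∣ ≡ k → suc ∣ p ∩ q ∣ ≡ k → ∣ p ∩ ∁ q ∣ ≡ 1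
∣p∣≡k⇒∣p∩∁q∣≡1 p q ∣p∣≡k 1+∣p∩q∣≡k = +-cancelˡ-≡ ∣ p ∩ q ∣ _ _ (begin
  ∣ p ∩ q ∣ + ∣ p ∩ ∁ q ∣ ≡⟨ ∣p∩q∣+∣p∩∁q∣≡∣p∣ p q ⟩
  ∣ p ∣                   ≡⟨ trans ∣p∣≡k (sym 1+∣p∩q∣≡k) ⟩
  suc ∣ p ∩ q ∣           ≡⟨ +-comm 1 _ ⟩
  ∣ p ∩ q ∣ + 1           ∎)
  where open ≡-Reasoning

∣p∣≡0⇒p≡⊥ : ∀ {m} (p : Subset m) → ∣ p ∣ ≡ 0 → p ≡ ⊥
∣p∣≡0⇒p≡⊥ []          _ = refl
∣p∣≡0⇒p≡⊥ (false ∷ p) h = cong (false ∷_) (∣p∣≡0⇒p≡⊥ p h)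

∣p∣≡1⇒p≡⁅x⁆ : ∀ {m} (p : Subset m) → ∣ p ∣ ≡ 1 → ∃ λ x → p ≡ ⁅ x ⁆
∣p∣≡1⇒p≡⁅x⁆ (true ∷ p)  h = zero , cong (true ∷_) (∣p∣≡0⇒p≡⊥ p (suc-injective h))
∣p∣≡1⇒p≡⁅x⁆ (false ∷ p) h with x , refl ← ∣p∣≡1⇒p≡⁅x⁆ p h = suc x , refl

∣p∩⁅x⁆∣≡[x∈p] : ∀ {m} (p : Subset m) x → ∣ p ∩ ⁅ x ⁆ ∣ ≡ (if lookup p x then 1 else 0)
∣p∩⁅x⁆∣≡[x∈p] {suc m} (true ∷ p)  zero    = cong suc (trans (cong ∣_∣ (∩-zeroʳ p)) (∣⊥∣≡0 m))
∣p∩⁅x⁆∣≡[x∈p] {suc m} (false ∷ p) zero    = trans (cong ∣_∣ (∩-zeroʳ p)) (∣⊥∣≡0 m)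
∣p∩⁅x⁆∣≡[x∈p]         (true ∷ p)  (suc x) = ∣p∩⁅x⁆∣≡[x∈p] p x
∣p∩⁅x⁆∣≡[x∈p]         (false ∷ p) (suc x) = ∣p∩⁅x⁆∣≡[x∈p] p x

∣p∩⁅x⁆∣≡∣p∩⁅y⁆∣ : ∀ {m} (p : Subset m) {x y} → lookup p x ≡ lookup p y → ∣ p ∩ ⁅ x ⁆ ∣ ≡ ∣ p ∩ ⁅ y ⁆ ∣
∣p∩⁅x⁆∣≡∣p∩⁅y⁆∣ p {x} {y} same = begin
  ∣ p ∩ ⁅ x ⁆ ∣                 ≡⟨ ∣p∩⁅x⁆∣≡[x∈p] p x ⟩
  (if lookup p x then 1 else 0) ≡⟨ cong (if_then 1 else 0) same ⟩
  (if lookup p y then 1 else 0) ≡⟨ ∣p∩⁅x⁆∣≡[x∈p] p y ⟨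
  ∣ p ∩ ⁅ y ⁆ ∣                 ∎
  where open ≡-Reasoning

∣p∩⁅x⁆∣≤1 : ∀ {m} (p : Subset m) x → ∣ p ∩ ⁅ x ⁆ ∣ ≤ 1
∣p∩⁅x⁆∣≤1 p x = ≤-trans (∣p∩q∣≤∣q∣ p ⁅ x ⁆) (≤-reflexive (∣⁅x⁆∣≡1 x))

distinct-members⇒3≤∣p∣ : ∀ {m} {p : Subset m} {x y z} → x ∈ p → y ∈ p → z ∈ p →
  x ≢ y → x ≢ z → y ≢ z → 3 ≤ ∣ p ∣
distinct-members⇒3≤∣p∣ {p = p} {x} {y} {z} x∈p y∈p z∈p x≢y x≢z y≢z = begin
  3                     ≤⟨ m≤m+n 3 _ ⟩
  3 + ∣ p - x - y - z ∣ ≤⟨ s≤s (s≤s (x∈p⇒∣p-x∣<∣p∣ z∈p-x-y)) ⟩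
  2 + ∣ p - x - y ∣     ≤⟨ s≤s (x∈p⇒∣p-x∣<∣p∣ y∈p-x) ⟩
  1 + ∣ p - x ∣         ≤⟨ x∈p⇒∣p-x∣<∣p∣ x∈p ⟩
  ∣ p ∣                 ∎
  where
  open ≤-Reasoning
  y∈p-x : y ∈ p - x
  y∈p-x = x∈p∧x≢y⇒x∈p-y y∈p (≢-sym x≢y)
  z∈p-x-y : z ∈ p - x - y
  z∈p-x-y = x∈p∧x≢y⇒x∈p-y (x∈p∧x≢y⇒x∈p-y z∈p (≢-sym x≢z)) (≢-sym y≢z)

lookup-⁅x⁆ : ∀ {m} (x : Fin m) → lookup ⁅ x ⁆ x ≡ true
lookup-⁅x⁆ x = []=⇒lookup (x∈⁅x⁆ x)

lookup-∩∁ : ∀ {m} (p q : Subset m) x → lookup (p ∩ ∁ q) x ≡ lookup p x ∧ not (lookup q x)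
lookup-∩∁ p q x = trans (lookup-zipWith _∧_ x p (∁ q)) (cong (lookup p x ∧_) (lookup-map x not q))

lookup-∩∁-∈ : ∀ {m} (p q : Subset m) {x} → lookup p x ≡ true → lookup (p ∩ ∁ q) x ≡ not (lookup q x)
lookup-∩∁-∈ p q {x} x∈p = trans (lookup-∩∁ p q x) (cong (_∧ not (lookup q x)) x∈p)

lookup-∩∁-∉ : ∀ {m} (p q : Subset m) {x} → lookup q x ≡ false → lookup (p ∩ ∁ q) x ≡ lookup p x
lookup-∩∁-∉ p q {x} x∉q =
  trans (lookup-∩∁ p q x) (trans (cong (λ b → lookup p x ∧ not b) x∉q) (∧-identityʳ _))

lookup-cong-∈ : ∀ {m} (p : Subset m) {x y} → (x ∈ p → y ∈ p) → (y ∈ p → x ∈ p) →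
  lookup p x ≡ lookup p y
lookup-cong-∈ p {x} {y} to from with lookup p x in px | lookup p y in py
... | true  | true  = refl
... | false | false = refl
... | true  | false = trans (sym ([]=⇒lookup (to (lookup⇒[]= x p px)))) py
... | false | true  = trans (sym px) ([]=⇒lookup (from (lookup⇒[]= y p py)))

-- Naming an element by a small set containing it

does-≡⇒ : ∀ {a b} {A : Set a} {B : Set b} (a? : Dec A) (b? : Dec B) → does a? ≡ does b? → A → B
does-≡⇒ (yes _) (yes b) _  _ = b
does-≡⇒ (no ¬a) _       _  a = ⊥-elim (¬a a)
does-≡⇒ (yes _) (no _)  () _

module _ {m : ℕ} (p : Subset m) where

  HasMemberBelow : Fin m → Set
  HasMemberBelow d = ∃ λ g → g <ᶠ d × g ∈ p

  hasMemberBelow? : ∀ d → Dec (HasMemberBelow d)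
  hasMemberBelow? d = any? λ g → (g <ᶠ? d) ×-dec (g ∈? p)

  member-below⇒3≤∣p∣ : ∀ {d d'} → d <ᶠ d' → d ∈ p → d' ∈ p → HasMemberBelow d → 3 ≤ ∣ p ∣
  member-below⇒3≤∣p∣ d<d' d∈p d'∈p (g , g<d , g∈p) =
    distinct-members⇒3≤∣p∣ g∈p d∈p d'∈p (<ᶠ⇒≢ g<d) (<ᶠ⇒≢ (<ᶠ-trans g<d d<d')) (<ᶠ⇒≢ d<d')

  ∣p∣≤2⇒member-determined-by-below : ∀ {d d'} → ∣ p ∣ ≤ 2 → d ∈ p → d' ∈ p →
    does (hasMemberBelow? d) ≡ does (hasMemberBelow? d') → d ≡ d'
  ∣p∣≤2⇒member-determined-by-below {d} {d'} ∣p∣≤2 d∈p d'∈p same with <-cmp d d'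
  ... | tri≈ _ d≡d' _ = d≡d'
  ... | tri< d<d' _ _ = ⊥-elim (<⇒≱ (member-below⇒3≤∣p∣ d<d' d∈p d'∈p
          (does-≡⇒ (hasMemberBelow? d') (hasMemberBelow? d) (sym same) (d , d<d' , d∈p))) ∣p∣≤2)
  ... | tri> _ _ d'<d = ⊥-elim (<⇒≱ (member-below⇒3≤∣p∣ d'<d d'∈p d∈p
          (does-≡⇒ (hasMemberBelow? d) (hasMemberBelow? d') same (d' , d'<d , d'∈p))) ∣p∣≤2)

ElementCode : ℕ → Set
ElementCode n = Maybe (Fin n × Bool)

module _ {m n : ℕ} (C : Fin n → Subset m) where

  smallMember? : ∀ d → Dec (∃ λ t → ∣ C t ∣ ≤ 2 × d ∈ C t)
  smallMember? d = any? λ t → (∣ C t ∣ ≤? 2) ×-dec (d ∈? C t)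

  -- All elements lying in no C t of size ≤ 2 get the code nothing; this is harmless because
  -- only membership in the small sets is ever read off a code.
  elementCode : Fin m → ElementCode n
  elementCode d with smallMember? d
  ... | yes (t , _) = just (t , does (hasMemberBelow? (C t) d))
  ... | no _        = nothing

  elementCode-≡⇒∈ : ∀ {d d' t} → elementCode d ≡ elementCode d' → ∣ C t ∣ ≤ 2 → d ∈ C t → d' ∈ C t
  elementCode-≡⇒∈ {d} {d'} same small d∈ with smallMember? d | smallMember? d'
  ... | no ¬small | _ = ⊥-elim (¬small (_ , small , d∈))
  ... | yes _ | no _ with () ← same
  ... | yes (t₀ , small₀ , d∈₀) | yes (_ , _ , d'∈₀)
    with refl , same-below ← ,-injective (just-injective same)
    = subst (_∈ C _) (∣p∣≤2⇒member-determined-by-below (C t₀) small₀ d∈₀ d'∈₀ same-below) d∈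

  elementCode-≡⇒lookup-≡ : ∀ {d d' t} → elementCode d ≡ elementCode d' → ∣ C t ∣ ≤ 2 →
    lookup (C t) d ≡ lookup (C t) d'
  elementCode-≡⇒lookup-≡ same small =
    lookup-cong-∈ _ (elementCode-≡⇒∈ same small) (elementCode-≡⇒∈ (sym same) small)

  memberCode : Subset m → ElementCode n
  memberCode S with nonempty? S
  ... | yes (d , _) = elementCode d
  ... | no _        = nothing

  memberCode-⁅⁆ : ∀ x → memberCode ⁅ x ⁆ ≡ elementCode x
  memberCode-⁅⁆ x with nonempty? ⁅ x ⁆
  ... | yes (d , d∈⁅x⁆) = cong elementCode (x∈⁅y⁆⇒x≡y x d∈⁅x⁆)
  ... | no empty        = ⊥-elim (empty (x , x∈⁅x⁆ x))

  memberCode-≡⇒elementCode-≡ : ∀ {S S' x x'} → S ≡ ⁅ x ⁆ → S' ≡ ⁅ x' ⁆ →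
    memberCode S ≡ memberCode S' → elementCode x ≡ elementCode x'
  memberCode-≡⇒elementCode-≡ {x = x} {x'} refl refl same =
    trans (sym (memberCode-⁅⁆ x)) (trans same (memberCode-⁅⁆ x'))

data Link : Set where
  equal adjacent apart : Link

link : ℕ → ℕ → Link
link k c with c ≟ k | suc c ≟ k
... | yes _ | _     = equal
... | no _  | yes _ = adjacent
... | no _  | no _  = apart

module _ {k c : ℕ} where

  link-equal : c ≡ k → link k c ≡ equal
  link-equal c≡k with c ≟ k
  ... | yes _  = refl
  ... | no c≢k = ⊥-elim (c≢k c≡k)

  link-adjacent : suc c ≡ k → link k c ≡ adjacent
  link-adjacent 1+c≡k with c ≟ k | suc c ≟ k
  ... | yes c≡k | _        = ⊥-elim (1+n≢n (trans 1+c≡k (sym c≡k)))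
  ... | no _    | yes _    = refl
  ... | no _    | no 1+c≢k = ⊥-elim (1+c≢k 1+c≡k)

  link-apart : c ≢ k → suc c ≢ k → link k c ≡ apart
  link-apart c≢k 1+c≢k with c ≟ k | suc c ≟ k
  ... | yes c≡k | _         = ⊥-elim (c≢k c≡k)
  ... | no _    | yes 1+c≡k = ⊥-elim (1+c≢k 1+c≡k)
  ... | no _    | no _      = refl

  link-equal⁻¹ : link k c ≡ equal → c ≡ k
  link-equal⁻¹ link≡ with c ≟ k | suc c ≟ k
  ... | yes c≡k | _     = c≡k
  ... | no _    | yes _ with () ← link≡
  ... | no _    | no _  with () ← link≡

  link-adjacent⁻¹ : link k c ≡ adjacent → suc c ≡ k
  link-adjacent⁻¹ link≡ with c ≟ k | suc c ≟ k
  ... | yes _ | _         with () ← link≡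
  ... | no _  | yes 1+c≡k = 1+c≡k
  ... | no _  | no _      with () ← link≡

  link-far : 2 + c ≤ k → link k c ≡ apart
  link-far 2+c≤k = link-apart (<⇒≢ (≤-trans (n≤1+n (suc c)) 2+c≤k)) (<⇒≢ 2+c≤k)

link-≡⇒equal⇔ : ∀ {k c c'} → link k c ≡ link k c' → c ≡ k ⇔ c' ≡ k
link-≡⇒equal⇔ same = mk⇔ (λ c≡k → link-equal⁻¹ (trans (sym same) (link-equal c≡k)))
                          (λ c'≡k → link-equal⁻¹ (trans same (link-equal c'≡k)))

link-≡⇒adjacent⇔ : ∀ {k c c'} → link k c ≡ link k c' → suc c ≡ k ⇔ suc c' ≡ k
link-≡⇒adjacent⇔ same = mk⇔ (λ 1+c≡k → link-adjacent⁻¹ (trans (sym same) (link-adjacent 1+c≡k)))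
                             (λ 1+c'≡k → link-adjacent⁻¹ (trans same (link-adjacent 1+c'≡k)))

record Swap {m : ℕ} (x y : Subset m) : Set where
  field
    removed added  : Fin m
    x∩∁y≡⁅removed⁆ : x ∩ ∁ y ≡ ⁅ removed ⁆
    y∩∁x≡⁅added⁆   : y ∩ ∁ x ≡ ⁅ added ⁆

  removed∈x : lookup x removed ≡ true
  removed∈x = ∧-conicalˡ _ _ (begin
    lookup x removed ∧ not (lookup y removed) ≡⟨ lookup-∩∁ x y removed ⟨
    lookup (x ∩ ∁ y) removed                  ≡⟨ cong (λ p → lookup p removed) x∩∁y≡⁅removed⁆ ⟩
    lookup ⁅ removed ⁆ removed                ≡⟨ lookup-⁅x⁆ removed ⟩
    true                                      ∎)
    where open ≡-Reasoning

  added∉x : lookup x added ≡ false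
  added∉x = not-injective (∧-conicalʳ _ _ (begin
    lookup y added ∧ not (lookup x added) ≡⟨ lookup-∩∁ y x added ⟨
    lookup (y ∩ ∁ x) added                ≡⟨ cong (λ p → lookup p added) y∩∁x≡⁅added⁆ ⟩
    lookup ⁅ added ⁆ added                ≡⟨ lookup-⁅x⁆ added ⟩
    true                                  ∎))
    where open ≡-Reasoning

  ∣w∩y∣+∣w∩⁅removed⁆∣≡∣w∩x∣+∣w∩⁅added⁆∣ : ∀ w →
    ∣ w ∩ y ∣ + ∣ w ∩ ⁅ removed ⁆ ∣ ≡ ∣ w ∩ x ∣ + ∣ w ∩ ⁅ added ⁆ ∣
  ∣w∩y∣+∣w∩⁅removed⁆∣≡∣w∩x∣+∣w∩⁅added⁆∣ w =
    subst₂ (λ r a → ∣ w ∩ y ∣ + ∣ w ∩ r ∣ ≡ ∣ w ∩ x ∣ + ∣ w ∩ a ∣) x∩∁y≡⁅removed⁆ y∩∁x≡⁅added⁆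
      (∣w∩y∣+∣w∩x∩∁y∣≡∣w∩x∣+∣w∩y∩∁x∣ w x y)

  ∣w∩y∣≤∣w∩x∣+1 : ∀ w → ∣ w ∩ y ∣ ≤ ∣ w ∩ x ∣ + 1
  ∣w∩y∣≤∣w∩x∣+1 w = begin
    ∣ w ∩ y ∣                       ≤⟨ m≤m+n _ _ ⟩
    ∣ w ∩ y ∣ + ∣ w ∩ ⁅ removed ⁆ ∣ ≡⟨ ∣w∩y∣+∣w∩⁅removed⁆∣≡∣w∩x∣+∣w∩⁅added⁆∣ w ⟩
    ∣ w ∩ x ∣ + ∣ w ∩ ⁅ added ⁆ ∣   ≤⟨ +-monoʳ-≤ ∣ w ∩ x ∣ (∣p∩⁅x⁆∣≤1 w added) ⟩
    ∣ w ∩ x ∣ + 1                   ∎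
    where open ≤-Reasoning

open Swap

adjacent⇒Swap : ∀ {m k} {x y : Subset m} → ∣ x ∣ ≡ k → ∣ y ∣ ≡ k → suc ∣ x ∩ y ∣ ≡ k → Swap x y
adjacent⇒Swap {x = x} {y} ∣x∣≡k ∣y∣≡k 1+∣x∩y∣≡k
  with r , x∩∁y≡⁅r⁆ ← ∣p∣≡1⇒p≡⁅x⁆ _ (∣p∣≡k⇒∣p∩∁q∣≡1 x y ∣x∣≡k 1+∣x∩y∣≡k)
     | a , y∩∁x≡⁅a⁆ ← ∣p∣≡1⇒p≡⁅x⁆ _
         (∣p∣≡k⇒∣p∩∁q∣≡1 y x ∣y∣≡k (trans (cong suc (∣p∩q∣≡∣q∩p∣ y x)) 1+∣x∩y∣≡k))
  = record { removed = r ; added = a ; x∩∁y≡⁅removed⁆ = x∩∁y≡⁅r⁆ ; y∩∁x≡⁅added⁆ = y∩∁x≡⁅a⁆ }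

-- Since |w ∩ y| ≤ |w ∩ x| + 1, a w missing three elements of x is apart from y and y';
-- otherwise |w ∩ y| is read off from the membership of the swapped elements in w.
swap-link : ∀ {m k} {x y y' w : Subset m} → ∣ x ∣ ≡ k → (s : Swap x y) (s' : Swap x y') →
  (∣ x ∩ ∁ w ∣ ≤ 2 →
     lookup w (removed s) ≡ lookup w (removed s') × lookup w (added s) ≡ lookup w (added s')) →
  link k ∣ w ∩ y ∣ ≡ link k ∣ w ∩ y' ∣
swap-link {k = k} {x} {y} {y'} {w} ∣x∣≡k s s' small⇒same with ∣ x ∩ ∁ w ∣ ≤? 2
... | yes small
  with same-removed , same-added ← small⇒same small
  = cong (link k) (+-cancelʳ-≡ _ _ _ (begin
  ∣ w ∩ y ∣ + ∣ w ∩ ⁅ removed s ⁆ ∣   ≡⟨ ∣w∩y∣+∣w∩⁅removed⁆∣≡∣w∩x∣+∣w∩⁅added⁆∣ s w ⟩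
  ∣ w ∩ x ∣ + ∣ w ∩ ⁅ added s ⁆ ∣     ≡⟨ cong (∣ w ∩ x ∣ +_) (∣p∩⁅x⁆∣≡∣p∩⁅y⁆∣ w same-added) ⟩
  ∣ w ∩ x ∣ + ∣ w ∩ ⁅ added s' ⁆ ∣    ≡⟨ ∣w∩y∣+∣w∩⁅removed⁆∣≡∣w∩x∣+∣w∩⁅added⁆∣ s' w ⟨
  ∣ w ∩ y' ∣ + ∣ w ∩ ⁅ removed s' ⁆ ∣ ≡⟨ cong (∣ w ∩ y' ∣ +_) (∣p∩⁅x⁆∣≡∣p∩⁅y⁆∣ w same-removed) ⟨
  ∣ w ∩ y' ∣ + ∣ w ∩ ⁅ removed s ⁆ ∣  ∎))
  where open ≡-Reasoning
... | no large = trans (far s) (sym (far s'))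
  where
  far : ∀ {z} → Swap x z → link k ∣ w ∩ z ∣ ≡ apart
  far {z} t = link-far (begin
    2 + ∣ w ∩ z ∣           ≤⟨ +-monoʳ-≤ 2 (∣w∩y∣≤∣w∩x∣+1 t w) ⟩
    2 + (∣ w ∩ x ∣ + 1)     ≡⟨ cong (2 +_) (+-comm _ 1) ⟩
    3 + ∣ w ∩ x ∣           ≤⟨ +-monoˡ-≤ ∣ w ∩ x ∣ (≰⇒> large) ⟩
    ∣ x ∩ ∁ w ∣ + ∣ w ∩ x ∣ ≡⟨ +-comm _ ∣ w ∩ x ∣ ⟩
    ∣ w ∩ x ∣ + ∣ x ∩ ∁ w ∣ ≡⟨ cong (_+ ∣ x ∩ ∁ w ∣) (∣p∩q∣≡∣q∩p∣ w x) ⟩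
    ∣ x ∩ w ∣ + ∣ x ∩ ∁ w ∣ ≡⟨ ∣p∩q∣+∣p∩∁q∣≡∣p∣ x w ⟩
    ∣ x ∣                   ≡⟨ ∣x∣≡k ⟩
    k                       ∎)
    where open ≤-Reasoning

-- Profiles of k-sets relative to a finite family of k-sets

data Profile (n : ℕ) : Set where
  equalTo      : Fin n → Profile n
  adjacentTo   : Fin n → ElementCode n → ElementCode n → Profile n
  apartFromAll : Profile n

module Profiles {m n k : ℕ} (P : Fin n → Subset m) (∣P∣≡k : ∀ t → ∣ P t ∣ ≡ k) where

  equalToMember? : ∀ y → Dec (∃ λ t → ∣ P t ∩ y ∣ ≡ k)
  equalToMember? y = any? λ t → ∣ P t ∩ y ∣ ≟ k

  adjacentToMember? : ∀ y → Dec (∃ λ t → suc ∣ P t ∩ y ∣ ≡ k)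
  adjacentToMember? y = any? λ t → suc ∣ P t ∩ y ∣ ≟ k

  P∖P : Fin n → Fin n → Subset m
  P∖P t u = P t ∩ ∁ (P u)

  removedCode : Fin n → Subset m → ElementCode n
  removedCode t y = memberCode (P∖P t) (P t ∩ ∁ y)

  addedCode : Fin n → Subset m → ElementCode n
  addedCode t y = memberCode (λ u → P∖P u t) (y ∩ ∁ (P t))

  profile : Subset m → Profile n
  profile y with equalToMember? y
  ... | yes (t , _) = equalTo t
  ... | no _ with adjacentToMember? y
  ...   | yes (t , _) = adjacentTo t (removedCode t y) (addedCode t y)
  ...   | no _        = apartFromAll

  profile≡equalTo⇒ : ∀ {y t} → profile y ≡ equalTo t → ∣ P t ∩ y ∣ ≡ k
  profile≡equalTo⇒ {y} same with equalToMember? y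
  profile≡equalTo⇒ refl | yes (_ , ∣Pt∩y∣≡k) = ∣Pt∩y∣≡k
  ... | no _ with adjacentToMember? y
  ...   | yes _ with () ← same
  ...   | no _  with () ← same

  profile≡adjacentTo⇒ : ∀ {y t r a} → profile y ≡ adjacentTo t r a →
    suc ∣ P t ∩ y ∣ ≡ k × removedCode t y ≡ r × addedCode t y ≡ a
  profile≡adjacentTo⇒ {y} same with equalToMember? y
  ... | yes _ with () ← same
  ... | no _ with adjacentToMember? y
  profile≡adjacentTo⇒ refl | no _ | yes (_ , 1+∣Pt∩y∣≡k) = 1+∣Pt∩y∣≡k , refl , refl
  ...   | no _ with () ← same

  profile≡apartFromAll⇒ : ∀ {y} → profile y ≡ apartFromAll → ∀ t → link k ∣ P t ∩ y ∣ ≡ apart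
  profile≡apartFromAll⇒ {y} same t with equalToMember? y
  ... | yes _ with () ← same
  ... | no ¬equal with adjacentToMember? y
  ...   | yes _ with () ← same
  ...   | no ¬adjacent = link-apart (λ h → ¬equal (t , h)) (λ h → ¬adjacent (t , h))

  profile≡equalTo⇒P≡ : ∀ {y t} → ∣ y ∣ ≡ k → profile y ≡ equalTo t → P t ≡ y
  profile≡equalTo⇒P≡ {y} {t} ∣y∣≡k py = ∣p∩q∣≡∣p∣≡∣q∣⇒p≡q (P t) y
    (trans (profile≡equalTo⇒ py) (sym (∣P∣≡k t))) (trans (profile≡equalTo⇒ py) (sym ∣y∣≡k))

  adjacent-link : ∀ {t₀ y y'} → ∣ y ∣ ≡ k → ∣ y' ∣ ≡ k →
    suc ∣ P t₀ ∩ y ∣ ≡ k → suc ∣ P t₀ ∩ y' ∣ ≡ k →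
    removedCode t₀ y ≡ removedCode t₀ y' → addedCode t₀ y ≡ addedCode t₀ y' →
    ∀ t → link k ∣ P t ∩ y ∣ ≡ link k ∣ P t ∩ y' ∣
  adjacent-link {t₀} {y} {y'} ∣y∣≡k ∣y'∣≡k y-adj y'-adj same-removed same-added t =
    swap-link (∣P∣≡k t₀) s s' λ small → removed-lookup small , added-lookup small
    where
    s  : Swap (P t₀) y
    s  = adjacent⇒Swap (∣P∣≡k t₀) ∣y∣≡k y-adj
    s' : Swap (P t₀) y'
    s' = adjacent⇒Swap (∣P∣≡k t₀) ∣y'∣≡k y'-adj
    removed-lookup : ∣ P∖P t₀ t ∣ ≤ 2 → lookup (P t) (removed s) ≡ lookup (P t) (removed s')
    removed-lookup small = not-injective (begin
      not (lookup (P t) (removed s))  ≡⟨ lookup-∩∁-∈ (P t₀) (P t) (removed∈x s) ⟨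
      lookup (P∖P t₀ t) (removed s)   ≡⟨ elementCode-≡⇒lookup-≡ (P∖P t₀) same-code small ⟩
      lookup (P∖P t₀ t) (removed s')  ≡⟨ lookup-∩∁-∈ (P t₀) (P t) (removed∈x s') ⟩
      not (lookup (P t) (removed s')) ∎)
      where
      open ≡-Reasoning
      same-code = memberCode-≡⇒elementCode-≡ (P∖P t₀)
        (x∩∁y≡⁅removed⁆ s) (x∩∁y≡⁅removed⁆ s') same-removed
    added-lookup : ∣ P∖P t₀ t ∣ ≤ 2 → lookup (P t) (added s) ≡ lookup (P t) (added s')
    added-lookup small = begin
      lookup (P t) (added s)        ≡⟨ lookup-∩∁-∉ (P t) (P t₀) (added∉x s) ⟨
      lookup (P∖P t t₀) (added s)   ≡⟨ elementCode-≡⇒lookup-≡ (λ u → P∖P u t₀) same-code small' ⟩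
      lookup (P∖P t t₀) (added s')  ≡⟨ lookup-∩∁-∉ (P t) (P t₀) (added∉x s') ⟩
      lookup (P t) (added s')       ∎
      where
      open ≡-Reasoning
      same-code = memberCode-≡⇒elementCode-≡ (λ u → P∖P u t₀)
        (y∩∁x≡⁅added⁆ s) (y∩∁x≡⁅added⁆ s') same-added
      small' = subst (_≤ 2) (∣p∩∁q∣≡∣q∩∁p∣ (P t₀) (P t) (trans (∣P∣≡k t₀) (sym (∣P∣≡k t)))) small

  profile-≡⇒link-≡ : ∀ {y y'} → ∣ y ∣ ≡ k → ∣ y' ∣ ≡ k → profile y ≡ profile y' →
    ∀ t → link k ∣ P t ∩ y ∣ ≡ link k ∣ P t ∩ y' ∣
  profile-≡⇒link-≡ {y} {y'} ∣y∣≡k ∣y'∣≡k same t with profile y in py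
  ... | equalTo t₀ = cong (λ z → link k ∣ P t ∩ z ∣)
    (trans (sym (profile≡equalTo⇒P≡ ∣y∣≡k py)) (profile≡equalTo⇒P≡ ∣y'∣≡k (sym same)))
  ... | adjacentTo t₀ r a
    with y-adj , removed-r , added-a ← profile≡adjacentTo⇒ py
       | y'-adj , removed-r' , added-a' ← profile≡adjacentTo⇒ (sym same)
    = adjacent-link ∣y∣≡k ∣y'∣≡k y-adj y'-adj
        (trans removed-r (sym removed-r')) (trans added-a (sym added-a')) t
  ... | apartFromAll = trans (profile≡apartFromAll⇒ py t) (sym (profile≡apartFromAll⇒ (sym same) t))

-- Quantifier-free formulas see only atomic types

module _ (G : Graph) {X : Set} where

  SameAtomicType : (ρ ρ' : X → V G) → Set
  SameAtomicType ρ ρ' = ∀ x y → (E G (ρ x) (ρ y) ⇔ E G (ρ' x) (ρ' y)) × (ρ x ≡ ρ y ⇔ ρ' x ≡ ρ' y)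

  Sat-cong : ∀ {ρ ρ'} → SameAtomicType ρ ρ' → ∀ φ → Sat G ρ φ ⇔ Sat G ρ' φ
  Sat-cong same tt         = ⇔-id _
  Sat-cong same ff         = ⇔-id _
  Sat-cong same (adj x y)  = proj₁ (same x y)
  Sat-cong same (eq x y)   = proj₂ (same x y)
  Sat-cong same (neg φ)    = →-cong-⇔ (Sat-cong same φ) (⇔-id _)
  Sat-cong same (conj φ ψ) = Sat-cong same φ ×-⇔ Sat-cong same ψ
  Sat-cong same (disj φ ψ) = Sat-cong same φ ⊎-⇔ Sat-cong same ψ

module _ {m k : ℕ} where

  overlapSize : (u v : V (Johnson m k)) → ℕ
  overlapSize u v = ∣ proj₁ u ∩ proj₁ v ∣

  ≡⇔overlapSize≡k : (u v : V (Johnson m k)) → u ≡ v ⇔ overlapSize u v ≡ k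
  ≡⇔overlapSize≡k (x , ∣x∣≡k) (y , ∣y∣≡k) = mk⇔ to from
    where
    to : (x , ∣x∣≡k) ≡ (y , ∣y∣≡k) → ∣ x ∩ y ∣ ≡ k
    to refl = trans (cong ∣_∣ (∩-idem x)) ∣x∣≡k
    from : ∣ x ∩ y ∣ ≡ k → (x , ∣x∣≡k) ≡ (y , ∣y∣≡k)
    from ∣x∩y∣≡k
      with refl ← ∣p∩q∣≡∣p∣≡∣q∣⇒p≡q x y (trans ∣x∩y∣≡k (sym ∣x∣≡k)) (trans ∣x∩y∣≡k (sym ∣y∣≡k))
      = cong (x ,_) (≡-irrelevant ∣x∣≡k ∣y∣≡k)

  link-≡⇒SameAtomicType : ∀ {X} {ρ ρ' : X → V (Johnson m k)} →
    (∀ x y → link k (overlapSize (ρ x) (ρ y)) ≡ link k (overlapSize (ρ' x) (ρ' y))) →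
    SameAtomicType (Johnson m k) ρ ρ'
  link-≡⇒SameAtomicType {ρ = ρ} {ρ'} same x y =
    link-≡⇒adjacent⇔ (same x y) ,
    (⇔-sym (≡⇔overlapSize≡k (ρ' x) (ρ' y)) ⇔-∘ (link-≡⇒equal⇔ (same x y) ⇔-∘ ≡⇔overlapSize≡k (ρ x) (ρ y)))

module _ {a b : ℕ} {A B : Set} where

  Fin-⊎ : A ↔ Fin a → B ↔ Fin b → (A ⊎ B) ↔ Fin (a + b)
  Fin-⊎ A↔ B↔ = ↔-sym +↔⊎ ↔-∘ (A↔ ⊎-↔ B↔)

  Fin-× : A ↔ Fin a → B ↔ Fin b → (A × B) ↔ Fin (a * b)
  Fin-× A↔ B↔ = ↔-sym *↔× ↔-∘ (A↔ ×-↔ B↔)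

Vec↔Fin^ : ∀ {A : Set} {a} → A ↔ Fin a → ∀ q → Vec A q ↔ Fin (a ^ q)
Vec↔Fin^ A↔ zero    = mk↔ₛ′ (λ _ → zero) (λ _ → []) (λ { zero → refl }) (λ { [] → refl })
Vec↔Fin^ A↔ (suc q) =
  Fin-× A↔ (Vec↔Fin^ A↔ q) ↔-∘ mk↔ₛ′ uncons (uncurry _∷_) (λ _ → refl) (λ { (_ ∷ _) → refl })

Maybe↔⊤⊎ : ∀ {A : Set} → Maybe A ↔ (⊤ ⊎ A)
Maybe↔⊤⊎ = mk↔ₛ′ (maybe inj₂ (inj₁ _)) (λ { (inj₁ _) → nothing ; (inj₂ x) → just x })
  (λ { (inj₁ _) → refl ; (inj₂ _) → refl }) (λ { nothing → refl ; (just _) → refl })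

Link↔Fin : Link ↔ Fin 3
Link↔Fin = mk↔ₛ′ to from (λ { zero → refl ; (suc zero) → refl ; (suc (suc zero)) → refl })
                         (λ { equal → refl ; adjacent → refl ; apart → refl })
  where
  to : Link → Fin 3
  to equal    = zero
  to adjacent = suc zero
  to apart    = suc (suc zero)
  from : Fin 3 → Link
  from zero             = equal
  from (suc zero)       = adjacent
  from (suc (suc zero)) = apart

elementCodeCount : ℕ → ℕ
elementCodeCount n = 1 + n * 2

ElementCode↔Fin : ∀ {n} → ElementCode n ↔ Fin (elementCodeCount n)
ElementCode↔Fin = Fin-⊎ (↔-sym 1↔⊤) (Fin-× (↔-id _) (↔-sym 2↔Bool)) ↔-∘ Maybe↔⊤⊎

profileCount : ℕ → ℕ
profileCount n = n + (n * (elementCodeCount n * elementCodeCount n) + 1)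

Profile↔Fin : ∀ {n} → Profile n ↔ Fin (profileCount n)
Profile↔Fin {n} =
  Fin-⊎ (↔-id _) (Fin-⊎ (Fin-× (↔-id _) (Fin-× ElementCode↔Fin ElementCode↔Fin)) (↔-sym 1↔⊤))
  ↔-∘ mk↔ₛ′ to from (λ { (inj₁ _) → refl ; (inj₂ (inj₁ _)) → refl ; (inj₂ (inj₂ _)) → refl })
                    (λ { (equalTo _) → refl ; (adjacentTo _ _ _) → refl ; apartFromAll → refl })
  where
  to : Profile n → Fin n ⊎ (Fin n × ElementCode n × ElementCode n) ⊎ ⊤
  to (equalTo t)        = inj₁ t
  to (adjacentTo t r a) = inj₂ (inj₁ (t , r , a))
  to apartFromAll       = inj₂ (inj₂ _)
  from : Fin n ⊎ (Fin n × ElementCode n × ElementCode n) ⊎ ⊤ → Profile n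
  from (inj₁ t)                  = equalTo t
  from (inj₂ (inj₁ (t , r , a))) = adjacentTo t r a
  from (inj₂ (inj₂ _))           = apartFromAll

Code : ℕ → ℕ → Set
Code q n = Vec (Vec Link q × Profile n) q

codeCount : ℕ → ℕ → ℕ
codeCount q n = (3 ^ q * profileCount n) ^ q

Code↔Fin : ∀ {q n} → Code q n ↔ Fin (codeCount q n)
Code↔Fin {q} = Vec↔Fin^ (Fin-× (Vec↔Fin^ Link↔Fin q) Profile↔Fin) q

Subset↔Fin : ∀ s → Subset s ↔ Fin (2 ^ s)
Subset↔Fin = Vec↔Fin^ (↔-sym 2↔Bool)

tabulate-injective : ∀ {A : Set} {n} {f g : Fin n → A} → tabulate f ≡ tabulate g → ∀ i → f i ≡ g i
tabulate-injective {f = f} {g} same i =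
  trans (sym (lookup∘tabulate f i)) (trans (cong (λ xs → lookup xs i) same) (lookup∘tabulate g i))

module _ {m k p q : ℕ} (φ : QF (Fin p ⊎ Fin q)) {s : ℕ} (a : Fin s → Fin p → V (Johnson m k)) where

  points : Fin (s * p) → V (Johnson m k)
  points t = uncurry a (remQuot p t)

  open Profiles (λ t → proj₁ (points t)) (λ t → proj₂ (points t))

  code : (Fin q → V (Johnson m k)) → Code q (s * p)
  code b = tabulate λ v → tabulate (λ v' → link k (overlapSize (b v) (b v'))) , profile (proj₁ (b v))

  code-≡⇒SameAtomicType : ∀ {b b'} → code b ≡ code b' → ∀ i →
    SameAtomicType (Johnson m k) [ a i , b ] [ a i , b' ]
  code-≡⇒SameAtomicType {b} {b'} same i = link-≡⇒SameAtomicType links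
    where
    same-row : ∀ v → tabulate (λ v' → link k (overlapSize (b v) (b v')))
                       ≡ tabulate (λ v' → link k (overlapSize (b' v) (b' v')))
                     × profile (proj₁ (b v)) ≡ profile (proj₁ (b' v))
    same-row v = ,-injective (tabulate-injective same v)
    point-parameter : ∀ u v → link k (overlapSize (a i u) (b v)) ≡ link k (overlapSize (a i u) (b' v))
    point-parameter u v = subst (λ x → link k ∣ proj₁ x ∩ _ ∣ ≡ link k ∣ proj₁ x ∩ _ ∣)
      (cong (uncurry a) (remQuot-combine i u))
      (profile-≡⇒link-≡ (proj₂ (b v)) (proj₂ (b' v)) (proj₂ (same-row v)) (combine i u))
    links : ∀ z z' → link k (overlapSize ([ a i , b ] z) ([ a i , b ] z'))
                   ≡ link k (overlapSize ([ a i , b' ] z) ([ a i , b' ] z'))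
    links (inj₁ u) (inj₁ u') = refl
    links (inj₁ u) (inj₂ v)  = point-parameter u v
    links (inj₂ v) (inj₁ u)  = subst₂ (λ c c' → link k c ≡ link k c')
      (∣p∩q∣≡∣q∩p∣ (proj₁ (a i u)) (proj₁ (b v))) (∣p∩q∣≡∣q∩p∣ (proj₁ (a i u)) (proj₁ (b' v)))
      (point-parameter u v)
    links (inj₂ v) (inj₂ v') = tabulate-injective (proj₁ (same-row v)) v'

  shattered⇒2^s≤codeCount : Shattered (Johnson m k) φ a → 2 ^ s ≤ codeCount q (s * p)
  shattered⇒2^s≤codeCount (_ , shatters) = injective⇒≤ (Injection.injective subsets↣codes)
    where
    parameters : Subset s → Fin q → V (Johnson m k)
    parameters S = proj₁ (shatters S)
    code-injective : ∀ {S T} → code (parameters S) ≡ code (parameters T) → S ≡ T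
    code-injective {S} {T} same =
      ⊆-antisym (λ {i} → Equivalence.to (i∈S⇔i∈T i)) (λ {i} → Equivalence.from (i∈S⇔i∈T i))
      where
      i∈S⇔i∈T : ∀ i → i ∈ S ⇔ i ∈ T
      i∈S⇔i∈T i = proj₂ (shatters T) i
        ⇔-∘ (Sat-cong _ (code-≡⇒SameAtomicType same i) φ ⇔-∘ ⇔-sym (proj₂ (shatters S) i))
    subsets↣codes : Fin (2 ^ s) ↣ Fin (codeCount q (s * p))
    subsets↣codes = ↔⇒↣ Code↔Fin ↣-∘ (mk↣ code-injective ↣-∘ ↔⇒↣ (↔-sym (Subset↔Fin s)))

1+2^n≤2^[1+n] : ∀ n → suc (2 ^ n) ≤ 2 ^ suc n
1+2^n≤2^[1+n] n = begin
  1 + 2 ^ n     ≤⟨ +-monoˡ-≤ (2 ^ n) (m^n>0 2 n) ⟩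
  2 ^ n + 2 ^ n ≡⟨ cong (2 ^ n +_) (+-identityʳ (2 ^ n)) ⟨
  2 ^ suc n     ∎
  where open ≤-Reasoning

n<2^n : ∀ n → n < 2 ^ n
n<2^n zero    = s≤s z≤n
n<2^n (suc n) = ≤-trans (s≤s (n<2^n n)) (1+2^n≤2^[1+n] n)

linear<2^ : ∀ a b → ∃ λ j → a * j + b < 2 ^ j
linear<2^ a b = n + n , (begin-strict
  a * (n + n) + b           <⟨ +-monoʳ-< (a * (n + n)) (≤-<-trans (m≤m*n b n) (m<m+n (b * n) z<s)) ⟩
  a * (n + n) + (b * n + n) ≡⟨ square a b ⟨
  n * n                     <⟨ *-mono-< (n<2^n n) (n<2^n n) ⟩
  2 ^ n * 2 ^ n             ≡⟨ ^-distribˡ-+-* 2 n n ⟨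
  2 ^ (n + n)               ∎)
  where
  open ≤-Reasoning
  n : ℕ
  n = suc (a * 2 + b)
  square : ∀ a b → suc (a * 2 + b) * suc (a * 2 + b)
                 ≡ a * (suc (a * 2 + b) + suc (a * 2 + b)) + (b * suc (a * 2 + b) + suc (a * 2 + b))
  square = solve-∀

poly<2^ : ∀ c d e → ∃ λ s → (c * suc s ^ d) ^ e < 2 ^ s
poly<2^ c d e with j , linear<2^j ← linear<2^ (d * e) ((c + d) * e) = 2 ^ j , (begin-strict
  (c * suc (2 ^ j) ^ d) ^ e     ≤⟨ ^-monoˡ-≤ e (*-mono-≤ (<⇒≤ (n<2^n c)) (^-monoˡ-≤ d (1+2^n≤2^[1+n] j))) ⟩
  (2 ^ c * (2 ^ suc j) ^ d) ^ e ≡⟨ cong (λ x → (2 ^ c * x) ^ e) (^-*-assoc 2 (suc j) d) ⟩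
  (2 ^ c * 2 ^ (suc j * d)) ^ e ≡⟨ cong (_^ e) (^-distribˡ-+-* 2 c (suc j * d)) ⟨
  (2 ^ (c + suc j * d)) ^ e     ≡⟨ ^-*-assoc 2 (c + suc j * d) e ⟩
  2 ^ ((c + suc j * d) * e)     ≡⟨ cong (2 ^_) (exponent c d e j) ⟩
  2 ^ (d * e * j + (c + d) * e) <⟨ ^-monoʳ-< 2 (s≤s (s≤s z≤n)) linear<2^j ⟩
  2 ^ 2 ^ j                     ∎)
  where
  open ≤-Reasoning
  exponent : ∀ c d e j → (c + suc j * d) * e ≡ d * e * j + (c + d) * e
  exponent = solve-∀

^-distribʳ-* : ∀ m n o → (m * n) ^ o ≡ m ^ o * n ^ o
^-distribʳ-* m n zero    = refl
^-distribʳ-* m n (suc o) = trans (cong (m * n *_) (^-distribʳ-* m n o)) (interchange m n (m ^ o) (n ^ o))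
  where
  interchange : ∀ a b c d → a * b * (c * d) ≡ a * c * (b * d)
  interchange = solve-∀

-- The ring solver does not handle _^_, so the cube is written out.
profileCount≤elementCodeCount^3 : ∀ n → profileCount n ≤ elementCodeCount n ^ 3
profileCount≤elementCodeCount^3 n = ≤-trans (m≤m+n _ _) (≤-reflexive (sym (cube n)))
  where
  cube : ∀ n → (1 + n * 2) * ((1 + n * 2) * ((1 + n * 2) * 1))
             ≡ (n + (n * ((1 + n * 2) * (1 + n * 2)) + 1))
               + (n * ((1 + n * 2) * (1 + n * 2)) + n * n * 4 + n * 3)
  cube = solve-∀

elementCodeCount≤ : ∀ p s → elementCodeCount (s * p) ≤ (1 + p * 2) * suc s
elementCodeCount≤ p s = ≤-trans (m≤m+n _ _) (≤-reflexive (sym (expand p s)))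
  where
  expand : ∀ p s → (1 + p * 2) * suc s ≡ (1 + s * p * 2) + (s + p * 2)
  expand = solve-∀

codeCount≤ : ∀ p q s → codeCount q (s * p) ≤ (3 ^ q * (1 + p * 2) ^ 3 * suc s ^ 3) ^ q
codeCount≤ p q s = ^-monoˡ-≤ q (begin
  3 ^ q * profileCount (s * p)          ≤⟨ *-monoʳ-≤ (3 ^ q) (profileCount≤elementCodeCount^3 (s * p)) ⟩
  3 ^ q * elementCodeCount (s * p) ^ 3  ≤⟨ *-monoʳ-≤ (3 ^ q) (^-monoˡ-≤ 3 (elementCodeCount≤ p s)) ⟩
  3 ^ q * ((1 + p * 2) * suc s) ^ 3     ≡⟨ cong (3 ^ q *_) (^-distribʳ-* (1 + p * 2) (suc s) 3) ⟩
  3 ^ q * ((1 + p * 2) ^ 3 * suc s ^ 3) ≡⟨ *-assoc (3 ^ q) _ _ ⟨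
  3 ^ q * (1 + p * 2) ^ 3 * suc s ^ 3   ∎)
  where open ≤-Reasoning

↑ˡ∈++⇔∈ : ∀ {s r} (S : Subset s) (T : Subset r) i → i ↑ˡ r ∈ S ++ T ⇔ i ∈ S
↑ˡ∈++⇔∈ S T i = mk⇔ (λ h → lookup⇒[]= i S (trans (sym (lookup-++ˡ S T i)) ([]=⇒lookup h)))
                     (λ h → lookup⇒[]= (i ↑ˡ _) (S ++ T) (trans (lookup-++ˡ S T i) ([]=⇒lookup h)))

Shattered-↑ˡ : ∀ {G : Graph} {p q} {φ : QF (Fin p ⊎ Fin q)} {s r} {a : Fin (s + r) → Fin p → V G} →
  Shattered G φ a → Shattered G φ (λ i → a (i ↑ˡ r))
Shattered-↑ˡ {G} {φ = φ} {r = r} {a} (a-injective , shatters) =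
  (λ same → ↑ˡ-injective r _ _ (a-injective same)) , traces
  where
  traces : ∀ S → Σ (Fin _ → V G) λ b → ∀ i → Sat G [ a (i ↑ˡ r) , b ] φ ⇔ i ∈ S
  traces S with b , b-traces ← shatters (S ++ ⊥) = b , λ i → ↑ˡ∈++⇔∈ S ⊥ i ⇔-∘ b-traces (i ↑ˡ r)

shattered-size≤ : ∀ {m k p q} (φ : QF (Fin p ⊎ Fin q)) {s₀ s} {a : Fin s → Fin p → V (Johnson m k)} →
  (3 ^ q * (1 + p * 2) ^ 3 * suc s₀ ^ 3) ^ q < 2 ^ s₀ → Shattered (Johnson m k) φ a → s ≤ s₀
shattered-size≤ {m} {k} {p} {q} φ {s₀} {s} {a} count<2^s₀ shattered with s ≤? s₀
... | yes s≤s₀ = s≤s₀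
... | no s≰s₀ with r , refl ← m≤n⇒∃[o]m+o≡n (<⇒≤ (≰⇒> s≰s₀)) =
  ⊥-elim (<⇒≱ count<2^s₀ (≤-trans (shattered⇒2^s≤codeCount φ a₀ shattered₀) (codeCount≤ p q s₀)))
  where
  a₀ : Fin s₀ → Fin p → V (Johnson m k)
  a₀ i = a (i ↑ˡ r)
  shattered₀ : Shattered (Johnson m k) φ a₀
  shattered₀ = Shattered-↑ˡ {Johnson m k} {φ = φ} shattered

mainTheorem7 : (p q : ℕ) (φ : QF (Fin p ⊎ Fin q)) → FiniteVCdimOnJohnson φ
mainTheorem7 p q φ = proj₁ bound , λ _ _ _ _ _ → shattered-size≤ φ (proj₂ bound)
  where
  bound : ∃ λ s₀ → (3 ^ q * (1 + p * 2) ^ 3 * suc s₀ ^ 3) ^ q < 2 ^ s₀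
  bound = poly<2^ (3 ^ q * (1 + p * 2) ^ 3) 3 q
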